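{- Let $G$ be a connected graph on $n$ vertices. For any edge $e=uv\in E(G)$, $n_u(e)+n_v(e)+\deg(u)+\deg(v)\le 2n$.
   Context: For an edge $e=uv$, $n_u(e)$ is the number of vertices $x$ with $d(x,u)<d(x,v)$, where $d$ is graph distance; $n_v(e)$ is defined symmetrically. -}

module Defs where

open import Data.Nat using (ℕ; zero; suc; _<_; _<?_)
open import Data.Fin using (Fin)
open import Data.Bool using (Bool; true; false; _∨_; if_then_else_)
open import Data.List using (List; filter; length)
open import Data.Bool.ListAction using (any)
open import Data.List using () renaming (allFin to allFinL)
open import Data.Product using (Σ; _×_)
open import Relation.Binary.PropositionalEquality using (_≡_)
open import Relation.Nullary using (¬_; Dec; does)
open import Data.Fin using (_≟_)

record Graph (n : ℕ) : Set₁ where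
  field
    Adj     : Fin n → Fin n → Set
    adj?    : (x y : Fin n) → Dec (Adj x y)
    sym     : ∀ {x y} → Adj x y → Adj y x
    irrefl  : ∀ {x} → ¬ Adj x x
open Graph public

data Walk {n : ℕ} (G : Graph n) : Fin n → Fin n → ℕ → Set where
  here : ∀ {x} → Walk G x x zero
  step : ∀ {x y z k} → Adj G x y → Walk G y z k → Walk G x z (suc k)

Connected : ∀ {n} → Graph n → Set
Connected {n} G = (x y : Fin n) → Σ ℕ (Walk G x y)

vertices : (n : ℕ) → List (Fin n)
vertices n = allFinL n

reach : ∀ {n} → Graph n → ℕ → Fin n → Fin n → Bool
reach G zero    x y = does (x ≟ y)
reach {n} G (suc k) x y =
  reach G k x y ∨ any (λ z → does (adj? G x z) Data.Bool.∧ reach G k z y) (vertices n)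

searchFrom : ∀ {n} → Graph n → Fin n → Fin n → ℕ → ℕ → ℕ
searchFrom G x y i zero       = i
searchFrom G x y i (suc fuel) =
  if reach G i x y then i else searchFrom G x y (suc i) fuel

-- Graph distance d(x,y): the least k such that a walk of length ≤ k
-- joins x and y (for a connected graph on n vertices, d(x,y) < n).
dist : ∀ {n} → Graph n → Fin n → Fin n → ℕ
dist {n} G x y = searchFrom G x y zero n

deg : ∀ {n} → Graph n → Fin n → ℕ
deg {n} G u = length (filter (adj? G u) (vertices n))

nNear : ∀ {n} → Graph n → Fin n → Fin n → ℕ
nNear {n} G u v = length (filter (λ x → dist G x u <? dist G x v) (vertices n))

module Submission where

-- For an edge uv we count, for every vertex x, its contribution to the four
-- quantities on the left-hand side:
--   [d(x,u) < d(x,v)] + [d(x,v) < d(x,u)] + [x ~ u] + [x ~ v].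
-- The two distance indicators are never both 1, and if x is adjacent to both
-- u and v then d(x,u) = d(x,v) = 1, so both distance indicators vanish.
-- Hence every vertex contributes at most 2, and summing over the n vertices
-- gives the bound 2n.

open import Defs
open import Data.Nat using (ℕ; zero; suc; _+_; _*_; _≤_; _<?_; z≤n; s≤s)
open import Data.Nat.Properties using (*-suc; +-mono-≤; +-assoc; <-asym)
open import Data.Fin using (Fin; _≟_)
open import Data.Bool using (Bool; true; false; _∧_)
open import Data.Bool.Properties using (∨-zeroʳ)
open import Data.Bool.ListAction using (any)
open import Data.List using (List; []; _∷_; filter; length)
open import Data.List.Properties using (length-tabulate)
open import Data.List.Relation.Unary.Any using (here; there)
open import Data.List.Membership.Propositional using (_∈_)
open import Data.List.Membership.Propositional.Properties using (∈-allFin)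
open import Data.Empty using (⊥-elim)
open import Data.Nat.Tactic.RingSolver using (solve-∀)
open import Relation.Binary.PropositionalEquality using (_≡_; _≢_; refl; subst)
open import Relation.Nullary using (Dec; yes; no; does)
open import Relation.Unary using (Pred; Decidable)
open import Level using (0ℓ)

indicator : ∀ {p} {P : Set p} → Dec P → ℕ
indicator (yes _) = 1
indicator (no _)  = 0

length-filter-∷ : ∀ {A : Set} {P : Pred A 0ℓ} (P? : Decidable P) x xs →
                  length (filter P? (x ∷ xs)) ≡ indicator (P? x) + length (filter P? xs)
length-filter-∷ P? x xs with P? x
... | yes _ = refl
... | no _  = refl

regroup : ∀ a b c d A B C D →
          (a + A) + (b + B) + (c + C) + (d + D) ≡ (a + b + c + d) + (A + B + C + D)
regroup = solve-∀

filter-count-bound :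
  ∀ {A : Set} {P Q R S : Pred A 0ℓ}
  (P? : Decidable P) (Q? : Decidable Q) (R? : Decidable R) (S? : Decidable S) (c : ℕ) →
  (∀ x → indicator (P? x) + indicator (Q? x) + indicator (R? x) + indicator (S? x) ≤ c) →
  ∀ xs → length (filter P? xs) + length (filter Q? xs)
         + length (filter R? xs) + length (filter S? xs) ≤ c * length xs
filter-count-bound P? Q? R? S? c pointwise [] = z≤n
filter-count-bound P? Q? R? S? c pointwise (x ∷ xs)
  rewrite length-filter-∷ P? x xs | length-filter-∷ Q? x xs
        | length-filter-∷ R? x xs | length-filter-∷ S? x xs
        | regroup (indicator (P? x)) (indicator (Q? x)) (indicator (R? x)) (indicator (S? x))
                  (length (filter P? xs)) (length (filter Q? xs))
                  (length (filter R? xs)) (length (filter S? xs))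
        | *-suc c (length xs)
  = +-mono-≤ (pointwise x) (filter-count-bound P? Q? R? S? c pointwise xs)

any-∈ : ∀ {A : Set} (p : A → Bool) {x : A} {xs : List A} → x ∈ xs → p x ≡ true → any p xs ≡ true
any-∈ p {xs = y ∷ ys} (here refl) px rewrite px = refl
any-∈ p {xs = y ∷ ys} (there x∈ys) px rewrite any-∈ p x∈ys px = ∨-zeroʳ (p y)

module _ {n : ℕ} (G : Graph n) where

  reach-zero-distinct : ∀ {x y} → x ≢ y → reach G 0 x y ≡ false
  reach-zero-distinct {x} {y} x≢y with x ≟ y
  ... | yes x≡y = ⊥-elim (x≢y x≡y)
  ... | no _    = refl

  adjacent-distinct : ∀ {x y} → Adj G x y → x ≢ y
  adjacent-distinct xy refl = irrefl G xy

  reach-one-adjacent : ∀ {x y} → Adj G x y → reach G 1 x y ≡ true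
  reach-one-adjacent {x} {y} xy
    rewrite reach-zero-distinct (adjacent-distinct xy)
    = any-∈ (λ z → does (adj? G x z) ∧ reach G 0 z y) (∈-allFin y) step-to-y
    where
    step-to-y : does (adj? G x y) ∧ does (y ≟ y) ≡ true
    step-to-y with adj? G x y | y ≟ y
    ... | yes _  | yes _  = refl
    ... | no ¬xy | _      = ⊥-elim (¬xy xy)
    ... | _      | no y≢y = ⊥-elim (y≢y refl)

  search-adjacent : ∀ {x y} → Adj G x y → ∀ fuel → searchFrom G x y 0 (suc fuel) ≡ 1
  search-adjacent xy zero rewrite reach-zero-distinct (adjacent-distinct xy) = refl
  search-adjacent xy (suc fuel)
    rewrite reach-one-adjacent xy | reach-zero-distinct (adjacent-distinct xy) = refl

dist-adjacent : ∀ {n} (G : Graph n) {x y : Fin n} → Adj G x y → dist G x y ≡ 1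
dist-adjacent {zero}  G {()} xy
dist-adjacent {suc m} G xy = search-adjacent G xy m

strictly-smaller-at-most-once : ∀ a b → indicator (a <? b) + indicator (b <? a) ≤ 1
strictly-smaller-at-most-once a b with a <? b | b <? a
... | yes a<b | yes b<a = ⊥-elim (<-asym a<b b<a)
... | yes _   | no _    = s≤s z≤n
... | no _    | yes _   = s≤s z≤n
... | no _    | no _    = z≤n

-- If x is adjacent to both u and v its distances to them are both 1, so the
-- distance indicators vanish; otherwise at most one adjacency indicator is 1.
vertex-contribution : ∀ {n} (G : Graph n) (u v x : Fin n) →
  indicator (dist G x u <? dist G x v) + indicator (dist G x v <? dist G x u)
  + indicator (adj? G u x) + indicator (adj? G v x) ≤ 2
vertex-contribution G u v x
  rewrite +-assoc (indicator (dist G x u <? dist G x v) + indicator (dist G x v <? dist G x u))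
                  (indicator (adj? G u x)) (indicator (adj? G v x))
  with adj? G u x | adj? G v x
... | yes ux | yes vx
  rewrite dist-adjacent G (sym G ux) | dist-adjacent G (sym G vx) = s≤s (s≤s z≤n)
... | yes _ | no _ = +-mono-≤ (strictly-smaller-at-most-once (dist G x u) (dist G x v)) (s≤s z≤n)
... | no _  | yes _ = +-mono-≤ (strictly-smaller-at-most-once (dist G x u) (dist G x v)) (s≤s z≤n)
... | no _  | no _  = +-mono-≤ (strictly-smaller-at-most-once (dist G x u) (dist G x v)) z≤n

length-vertices : ∀ n → length (vertices n) ≡ n
length-vertices n = length-tabulate {n = n} (λ i → i)

lemma20 : (n : ℕ) (G : Graph n) → Connected G →
          (u v : Fin n) → Adj G u v →
          nNear G u v + nNear G v u + deg G u + deg G v ≤ 2 * n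
lemma20 n G _ u v _ =
  subst (λ k → nNear G u v + nNear G v u + deg G u + deg G v ≤ 2 * k)
        (length-vertices n)
        (filter-count-bound (λ x → dist G x u <? dist G x v) (λ x → dist G x v <? dist G x u)
                            (adj? G u) (adj? G v) 2 (vertex-contribution G u v) (vertices n))
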